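{- For $n\ge 0$ and $k\ge 0$, the number $v_{n,k}$ of tilings of the honeycomb strip $H_n$ by monomers, slanted dimers and trimers using exactly $k$ monomers is $$v_{n,k}=\sum_{\substack{i_0,\dots,i_k> 0\\ i_0+\cdots+i_k=n+2k+3}}P_{i_0}P_{i_1}\cdots P_{i_k},$$ where $P_j$ is the Padovan sequence: $P_0=1$, $P_1=P_2=0$ and $P_j=P_{j-2}+P_{j-3}$ for $j\ge 3$.
   Context: The honeycomb strip $H_n$ consists of $n$ regular hexagons numbered $1,\dots,n$ arranged in two rows (odd-numbered on the bottom, even-numbered on top), hexagon $i$ sharing an edge with hexagons $i\pm1$ and $i\pm2$. The allowed tiles are: monomers $\{i\}$, slanted dimers $\{i,i+1\}$, and trimers $\{i,i+1,i+2\}$ (horizontal dimers $\{i,i+2\}$ are not allowed); a tiling is a partition of the hexagons of $H_n$ into such tiles, and $H_0$ has one (empty) tiling. -}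

module Defs where

open import Data.Nat using (ℕ; zero; suc; _+_; _*_; _∸_)
open import Data.List using (List; map)
open import Data.Nat.ListAction using (sum)
open import Data.List.Base using (upTo)

P : ℕ → ℕ
P zero = 1
P (suc zero) = 0
P (suc (suc zero)) = 0
P (suc (suc (suc j))) = P (suc j) + P j

-- Every allowed tile is a block of
-- consecutive hexagons {i}, {i,i+1}, {i,i+1,i+2}; a tiling is determined by
-- its tile covering the last hexagon n together with a tiling of the rest.
data Tiling : ℕ → Set where
  empty  : Tiling 0
  mono   : ∀ {n} → Tiling n → Tiling (suc n)
  dimer  : ∀ {n} → Tiling n → Tiling (suc (suc n))
  trimer : ∀ {n} → Tiling n → Tiling (suc (suc (suc n)))

monomers : ∀ {n} → Tiling n → ℕ
monomers empty      = 0
monomers (mono t)   = suc (monomers t)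
monomers (dimer t)  = monomers t
monomers (trimer t) = monomers t

-- compSum m N = Σ over (i_1,…,i_m) with all i_j > 0 and i_1+…+i_m = N
--               of P i_1 * … * P i_m   (expanded along the first index)
compSum : ℕ → ℕ → ℕ
compSum zero zero = 1
compSum zero (suc N) = 0
compSum (suc m) N = sum (map (λ j → P (suc j) * compSum m (N ∸ suc j)) (upTo N))

-- Removing the last tile of a tiling of H (n+1) leaves a tiling of H n, H (n-1) or H (n-2),
-- with one monomer fewer in the first case, so v (n+1) k = v n (k-1) + v (n-1) k + v (n-2) k.
-- Writing Q m N for compSum m N (the right-hand side has m = k + 1), expanding Q along its
-- first part and splitting P (j+3) = P (j+1) + P j gives the same recurrence
-- Q (m+1) (N+3) = Q m N + Q (m+1) (N+1) + Q (m+1) N with N = n + 2k + 1.  Since P 1 = P 2 = 0,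
-- only parts ≥ 3 contribute, so Q m N = 0 for N < 3m; this supplies the boundary values.
module Submission where

open import Defs
open import Data.Nat using (ℕ; zero; suc; _+_; _*_; _∸_; _≤_; _<_; s≤s; z≤n)
open import Data.Nat.Properties
  using ( suc-injective; m∸n≤m; ≤-<-trans; ≤-trans; ≤-reflexive; +-monoˡ-≤; +-comm
        ; *-zeroʳ; *-identityˡ; *-distribʳ-+)
open import Data.Nat.ListAction using (sum)
open import Data.Nat.Tactic.RingSolver using (solve-∀)
open import Data.List.Base using (applyUpTo)
open import Data.List.Properties using (map-upTo)
open import Data.Fin using (Fin; zero)
open import Data.Fin.Properties using (0↔⊥; +↔⊎)
open import Data.Empty using (⊥)
open import Relation.Nullary using (¬_; contradiction)
open import Data.Product using (Σ; _,_)
open import Data.Sum using (_⊎_; inj₁; inj₂)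
open import Data.Sum.Function.Propositional using (_⊎-↔_)
open import Function using (_∘_)
open import Function.Bundles using (_↔_; mk↔ₛ′)
open import Function.Properties.Inverse using (↔-refl; ↔-sym; ↔-trans)
open import Relation.Binary.PropositionalEquality using (_≡_; refl; sym; trans; cong; cong₂)
open Relation.Binary.PropositionalEquality.≡-Reasoning

sum-applyUpTo-+ : ∀ (f g : ℕ → ℕ) N →
  sum (applyUpTo (λ i → f i + g i) N) ≡ sum (applyUpTo f N) + sum (applyUpTo g N)
sum-applyUpTo-+ f g zero = refl
sum-applyUpTo-+ f g (suc N) = begin
  f 0 + g 0 + sum (applyUpTo (λ i → f (suc i) + g (suc i)) N)
    ≡⟨ cong (f 0 + g 0 +_) (sum-applyUpTo-+ (f ∘ suc) (g ∘ suc) N) ⟩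
  f 0 + g 0 + (sum (applyUpTo (f ∘ suc) N) + sum (applyUpTo (g ∘ suc) N))
    ≡⟨ interchange (f 0) (g 0) _ _ ⟩
  f 0 + sum (applyUpTo (f ∘ suc) N) + (g 0 + sum (applyUpTo (g ∘ suc) N)) ∎
  where
  interchange : ∀ a b c d → a + b + (c + d) ≡ a + c + (b + d)
  interchange = solve-∀

sum-applyUpTo-cong : ∀ {f g : ℕ → ℕ} → (∀ i → f i ≡ g i) → ∀ N →
  sum (applyUpTo f N) ≡ sum (applyUpTo g N)
sum-applyUpTo-cong f≗g zero = refl
sum-applyUpTo-cong f≗g (suc N) = cong₂ _+_ (f≗g 0) (sum-applyUpTo-cong (f≗g ∘ suc) N)

sum-applyUpTo-≡0 : ∀ (f : ℕ → ℕ) N → (∀ i → i < N → f i ≡ 0) → sum (applyUpTo f N) ≡ 0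
sum-applyUpTo-≡0 f zero f≡0 = refl
sum-applyUpTo-≡0 f (suc N) f≡0 =
  cong₂ _+_ (f≡0 0 (s≤s z≤n)) (sum-applyUpTo-≡0 (f ∘ suc) N (λ i i<N → f≡0 (suc i) (s≤s i<N)))

compSum-suc : ∀ m N →
  compSum (suc m) N ≡ sum (applyUpTo (λ j → P (suc j) * compSum m (N ∸ suc j)) N)
compSum-suc m N = cong sum (map-upTo _ N)

compSum≡0 : ∀ m N → N < m * 3 → compSum m N ≡ 0
compSum≡0 (suc m) N N<3m+3 = trans (compSum-suc m N) (sum-applyUpTo-≡0 _ N (term≡0 N N<3m+3))
  where
  term≡0 : ∀ N → N < suc m * 3 → ∀ j → j < N → P (suc j) * compSum m (N ∸ suc j) ≡ 0
  term≡0 N _ zero          _ = refl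
  term≡0 N _ (suc zero)    _ = refl
  term≡0 (suc (suc (suc N))) (s≤s (s≤s (s≤s N<3m))) (suc (suc j)) (s≤s (s≤s (s≤s _))) =
    trans (cong (P (suc (suc (suc j))) *_) (compSum≡0 m (N ∸ j) (≤-<-trans (m∸n≤m N j) N<3m)))
          (*-zeroʳ (P (suc (suc (suc j)))))

compSum-recurrence : ∀ m N →
  compSum (suc m) (3 + N) ≡ compSum m N + (compSum (suc m) (1 + N) + compSum (suc m) N)
compSum-recurrence m N = begin
  compSum (suc m) (3 + N)
    -- the terms j = 0, 1 vanish, j = 2 is P 3 * Q N, and P (i + 4) unfolds to P (i + 2) + P (i + 1)
    ≡⟨ compSum-suc m (3 + N) ⟩
  1 * Q N + sum (applyUpTo (λ i → (P (suc (suc i)) + P (suc i)) * Q (N ∸ suc i)) N)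
    ≡⟨ cong₂ _+_ (*-identityˡ (Q N)) (sum-applyUpTo-cong distrib N) ⟩
  Q N + sum (applyUpTo (λ i → P (suc (suc i)) * Q (N ∸ suc i) + P (suc i) * Q (N ∸ suc i)) N)
    ≡⟨ cong (Q N +_) (sum-applyUpTo-+ _ _ N) ⟩
  Q N + (sum (applyUpTo (λ i → P (suc (suc i)) * Q (N ∸ suc i)) N)
         + sum (applyUpTo (λ i → P (suc i) * Q (N ∸ suc i)) N))
    ≡⟨ cong (Q N +_) (sym (cong₂ _+_ (compSum-suc m (1 + N)) (compSum-suc m N))) ⟩
  Q N + (compSum (suc m) (1 + N) + compSum (suc m) N) ∎
  where
  Q : ℕ → ℕ
  Q = compSum m
  distrib : ∀ i → (P (suc (suc i)) + P (suc i)) * Q (N ∸ suc i)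
                ≡ P (suc (suc i)) * Q (N ∸ suc i) + P (suc i) * Q (N ∸ suc i)
  distrib i = *-distribʳ-+ (Q (N ∸ suc i)) (P (suc (suc i))) (P (suc i))

+-double<*3 : ∀ j k → j ≤ 2 + k → j + (k + k) < suc k * 3
+-double<*3 j k j≤2+k = ≤-trans (s≤s (+-monoˡ-≤ (k + k) j≤2+k)) (≤-reflexive (triple k))
  where
  triple : ∀ k → suc ((2 + k) + (k + k)) ≡ suc k * 3
  triple = solve-∀

Fin-cong : ∀ {m n} → m ≡ n → Fin m ↔ Fin n
Fin-cong refl = ↔-refl

¬A⇒A↔Fin0 : ∀ {A : Set} {m} → ¬ A → m ≡ 0 → A ↔ Fin m
¬A⇒A↔Fin0 ¬a refl = mk↔ₛ′ (λ a → contradiction a ¬a) (λ ()) (λ ()) (λ a → contradiction a ¬a)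

Fin-+↔⊎ : ∀ a b c → Fin (a + (b + c)) ↔ (Fin a ⊎ (Fin b ⊎ Fin c))
Fin-+↔⊎ a b c = ↔-trans +↔⊎ (↔-refl ⊎-↔ +↔⊎)

Σ-suc≡suc↔ : ∀ {A : Set} (f : A → ℕ) k → Σ A (λ a → suc (f a) ≡ suc k) ↔ Σ A (λ a → f a ≡ k)
Σ-suc≡suc↔ f k = mk↔ₛ′ (λ (a , p) → a , suc-injective p) (λ (a , p) → a , cong suc p)
  (λ { (a , refl) → refl }) (λ { (a , refl) → refl })

Tilings : ℕ → ℕ → Set
Tilings n k = Σ (Tiling n) (λ t → monomers t ≡ k)

AtPred : (ℕ → Set) → ℕ → Set
AtPred A zero    = ⊥
AtPred A (suc n) = A n

LastTile : ℕ → ℕ → Set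
LastTile n k = Σ (Tiling n) (λ t → suc (monomers t) ≡ k)
             ⊎ (AtPred (λ m → Tilings m k) n ⊎ AtPred (AtPred (λ m → Tilings m k)) n)

removeLastTile : ∀ {n k} → Tilings (suc n) k → LastTile n k
removeLastTile (mono t   , p) = inj₁ (t , p)
removeLastTile (dimer t  , p) = inj₂ (inj₁ (t , p))
removeLastTile (trimer t , p) = inj₂ (inj₂ (t , p))

addLastTile : ∀ n {k} → LastTile n k → Tilings (suc n) k
addLastTile n             (inj₁ (t , p))        = mono t , p
addLastTile (suc n)       (inj₂ (inj₁ (t , p))) = dimer t , p
addLastTile (suc (suc n)) (inj₂ (inj₂ (t , p))) = trimer t , p

Tilings-suc↔LastTile : ∀ n k → Tilings (suc n) k ↔ LastTile n k
Tilings-suc↔LastTile n k =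
  mk↔ₛ′ removeLastTile (addLastTile n) removeLastTile-addLastTile addLastTile-removeLastTile
  where
  removeLastTile-addLastTile : ∀ {m} x → removeLastTile (addLastTile m {k} x) ≡ x
  removeLastTile-addLastTile {m}           (inj₁ _)        = refl
  removeLastTile-addLastTile {suc m}       (inj₂ (inj₁ _)) = refl
  removeLastTile-addLastTile {suc (suc m)} (inj₂ (inj₂ _)) = refl
  addLastTile-removeLastTile : ∀ x → addLastTile n (removeLastTile {n} {k} x) ≡ x
  addLastTile-removeLastTile (mono _   , _) = refl
  addLastTile-removeLastTile (dimer _  , _) = refl
  addLastTile-removeLastTile (trimer _ , _) = refl

mutual
  Tilings↔Fin : ∀ n k → Tilings n k ↔ Fin (compSum (suc k) (3 + (n + (k + k))))
  Tilings↔Fin zero zero =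
    mk↔ₛ′ (λ _ → zero) (λ _ → empty , refl) (λ { zero → refl }) (λ { (empty , refl) → refl })
  Tilings↔Fin zero (suc k) = ¬A⇒A↔Fin0 (λ { (empty , ()) })
    (compSum≡0 (suc (suc k)) _ (+-double<*3 3 (suc k) (s≤s (s≤s (s≤s z≤n)))))
  Tilings↔Fin (suc n) k =
    ↔-trans (Tilings-suc↔LastTile n k)
    (↔-trans (monomerLast↔Fin n k ⊎-↔ (dimerLast↔Fin n k ⊎-↔ trimerLast↔Fin n k))
    (↔-trans (↔-sym (Fin-+↔⊎ _ _ _))
             (Fin-cong (sym (compSum-recurrence k (suc (n + (k + k))))))))

  monomerLast↔Fin : ∀ n k →
    Σ (Tiling n) (λ t → suc (monomers t) ≡ k) ↔ Fin (compSum k (suc (n + (k + k))))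
  monomerLast↔Fin n zero    = ¬A⇒A↔Fin0 (λ ()) refl
  monomerLast↔Fin n (suc k) =
    ↔-trans (Σ-suc≡suc↔ monomers k)
    (↔-trans (Tilings↔Fin n k) (Fin-cong (cong (compSum (suc k)) (shift n k))))
    where
    shift : ∀ n k → 3 + (n + (k + k)) ≡ suc (n + (suc k + suc k))
    shift = solve-∀

  dimerLast↔Fin : ∀ n k →
    AtPred (λ m → Tilings m k) n ↔ Fin (compSum (suc k) (2 + (n + (k + k))))
  dimerLast↔Fin zero    k = ¬A⇒A↔Fin0 (λ ()) (compSum≡0 (suc k) _ (+-double<*3 2 k (s≤s (s≤s z≤n))))
  dimerLast↔Fin (suc n) k = Tilings↔Fin n k

  trimerLast↔Fin : ∀ n k →
    AtPred (AtPred (λ m → Tilings m k)) n ↔ Fin (compSum (suc k) (1 + (n + (k + k))))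
  trimerLast↔Fin zero          k = ¬A⇒A↔Fin0 (λ ()) (compSum≡0 (suc k) _ (+-double<*3 1 k (s≤s z≤n)))
  trimerLast↔Fin (suc zero)    k = ¬A⇒A↔Fin0 (λ ()) (compSum≡0 (suc k) _ (+-double<*3 2 k (s≤s (s≤s z≤n))))
  trimerLast↔Fin (suc (suc n)) k = Tilings↔Fin n k

theorem11 : (n k : ℕ) →
    Σ (Tiling n) (λ t → monomers t ≡ k) ↔ Fin (compSum (k + 1) (n + 2 * k + 3))
theorem11 n k = ↔-trans (Tilings↔Fin n k) (Fin-cong (cong₂ compSum (+-comm 1 k) (reorder n k)))
  where
  reorder : ∀ n k → 3 + (n + (k + k)) ≡ n + 2 * k + 3
  reorder = solve-∀
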